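{- For all nonnegative integers $n,k,m$, the number $w_{n,k,m}$ of Dyck paths of semilength $n$ with exactly $k$ $UD$-factors and exactly $m$ $UUD$-factors equals the number of plane trees with $n$ non-root vertices, $k$ leaves, and $m$ good leaves.
   Context: A Dyck path of semilength $n$ is a word in the letters $U,D$ with $n$ copies of each letter such that no prefix contains more $D$'s than $U$'s; a $UD$-factor (resp. $UUD$-factor) is an occurrence of $UD$ (resp. $UUD$) as a consecutive subword. A plane tree is a rooted tree in which the children of each vertex are linearly ordered (left to right). A leaf is a non-root vertex with no children (the root is never a leaf, even if it is the only vertex). A good leaf is a leaf that is the leftmost (oldest) child of a non-root vertex. -}

module Defs where

open import Data.Nat using (ℕ; zero; suc; _+_; _≤ᵇ_)
open import Data.Bool using (Bool; true; false; _∧_; T)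
open import Data.List using (List; []; _∷_; inits; tails; filter; length)
open import Data.Product using (_×_)
open import Relation.Binary.PropositionalEquality using (_≡_)

data Step : Set where
  U D : Step

countU : List Step → ℕ
countU []       = 0
countU (U ∷ w)  = suc (countU w)
countU (D ∷ w)  = countU w

countD : List Step → ℕ
countD []       = 0
countD (U ∷ w)  = countD w
countD (D ∷ w)  = suc (countD w)

allB : {A : Set} → (A → Bool) → List A → Bool
allB p []       = true
allB p (x ∷ xs) = p x ∧ allB p xs

prefixesOK : List Step → Bool
prefixesOK w = allB (λ p → countD p ≤ᵇ countU p) (inits w)

IsDyckPath : ℕ → List Step → Set
IsDyckPath n w = T (prefixesOK w) × countU w ≡ n × countD w ≡ n

stepEq : Step → Step → Bool
stepEq U U = true
stepEq D D = true
stepEq _ _ = false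

isPrefixOf : List Step → List Step → Bool
isPrefixOf []       _        = true
isPrefixOf (_ ∷ _)  []       = false
isPrefixOf (a ∷ p)  (b ∷ w)  = stepEq a b ∧ isPrefixOf p w

occurrences : List Step → List Step → ℕ
occurrences p w = length (filter (λ t → T? (isPrefixOf p t)) (tails w))
  where
  open import Relation.Nullary.Decidable using (Dec)
  open import Data.Bool.Properties using (T?)

UD-factors : List Step → ℕ
UD-factors = occurrences (U ∷ D ∷ [])

UUD-factors : List Step → ℕ
UUD-factors = occurrences (U ∷ U ∷ D ∷ [])

data PlaneTree : Set where
  node : List PlaneTree → PlaneTree

verticesF : List PlaneTree → ℕ
verticesF []             = 0
verticesF (node cs ∷ ts) = suc (verticesF cs + verticesF ts)

nonRootVertices : PlaneTree → ℕ
nonRootVertices (node cs) = verticesF cs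

leavesF : List PlaneTree → ℕ
leavesF []                   = 0
leavesF (node [] ∷ ts)       = suc (leavesF ts)
leavesF (node (c ∷ cs) ∷ ts) = leavesF (c ∷ cs) + leavesF ts

leaves : PlaneTree → ℕ
leaves (node cs) = leavesF cs

leftmostIsLeaf : List PlaneTree → ℕ
leftmostIsLeaf (node [] ∷ _) = 1
leftmostIsLeaf _             = 0

-- good leaves in a forest of subtrees hanging below some vertex:
-- each vertex of the forest is non-root, so its leftmost child counts if a leaf
goodLeavesF : List PlaneTree → ℕ
goodLeavesF []             = 0
goodLeavesF (node cs ∷ ts) = leftmostIsLeaf cs + goodLeavesF cs + goodLeavesF ts

-- good leaves: leaves that are the leftmost child of a non-root vertex
goodLeaves : PlaneTree → ℕ
goodLeaves (node cs) = goodLeavesF cs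

-- The children c₁, …, c_r of the root of a plane tree are coded by the depth-first word
-- U w(c₁) D ⋯ U w(c_r) D, where w(c) codes the forest of children of c; this is the classical
-- bijection between plane trees with n non-root vertices and Dyck paths of semilength n.
-- A UD factor is the U of a vertex immediately followed by its own D, i.e. a leaf, and a UUD
-- factor is a non-root vertex whose leftmost child is a leaf, i.e. a good leaf. Since the word of
-- a non-empty forest ends with D, no such factor straddles the end of a forest word, so all
-- statistics are additive over the depth-first decomposition. The inverse is a stack-machine
-- decoder, and every Dyck path is in the image because a nonnegative walk from height h down to 0
-- splits as f₀ D f₁ D ⋯ D f_h with forest words f_i.
module Submission where

open import Defs
open import Data.Bool using (Bool; true; false; _∧_; T)
open import Data.Bool.Properties using (T-irrelevant)
open import Data.Unit using (tt)
open import Data.List using (List; []; _∷_; map; length; inits; reverse; _ʳ++_)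
open import Data.List.Properties using (reverse-involutive)
open import Data.Nat using (ℕ; zero; suc; _+_; _≤ᵇ_)
open import Data.Nat.Properties using (+-assoc; +-suc; +-identityʳ; suc-injective; ≡-irrelevant)
open import Data.Product using (Σ; ∃; ∃₂; _×_; _,_; proj₁)
open import Data.Product.Properties using (Σ-≡,≡→≡)
open import Function.Bundles using (_↔_; mk↔ₛ′)
open import Relation.Nullary.Irrelevant using (Irrelevant)
open import Relation.Binary.PropositionalEquality
  using (_≡_; refl; sym; trans; cong; cong₂; subst; module ≡-Reasoning)

×-irrelevant : {A B : Set} → Irrelevant A → Irrelevant B → Irrelevant (A × B)
×-irrelevant irrA irrB (a , b) (a′ , b′) = cong₂ _,_ (irrA a a′) (irrB b b′)

Σ-irrelevant-↔ : {A B : Set} {P : A → Set} {Q : B → Set} →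
  (∀ a → Irrelevant (P a)) → (∀ b → Irrelevant (Q b)) →
  (to : A → B) (from : B → A) →
  (∀ a → P a → Q (to a)) → (∀ b → Q b → P (from b)) →
  (∀ a → P a → from (to a) ≡ a) → (∀ b → to (from b) ≡ b) →
  Σ A P ↔ Σ B Q
Σ-irrelevant-↔ irrP irrQ to from to-Q from-P from∘to to∘from = mk↔ₛ′
  (λ (a , p) → to a , to-Q a p)
  (λ (b , q) → from b , from-P b q)
  (λ (b , q) → Σ-≡,≡→≡ (to∘from b , irrQ _ _ _))
  (λ (a , p) → Σ-≡,≡→≡ (from∘to a p , irrP _ _ _))

allB-map : {A B : Set} (p : B → Bool) {q : A → Bool} (f : A → B) →
  (∀ x → p (f x) ≡ q x) → ∀ xs → allB p (map f xs) ≡ allB q xs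
allB-map p f pf≗q []       = refl
allB-map p f pf≗q (x ∷ xs) = cong₂ _∧_ (pf≗q x) (allB-map p f pf≗q xs)

suc-≤ᵇ-suc : ∀ a b → (suc a ≤ᵇ suc b) ≡ (a ≤ᵇ b)
suc-≤ᵇ-suc zero    b = refl
suc-≤ᵇ-suc (suc a) b = refl

+-trans : ∀ {x y z} a b → x ≡ a + y → y ≡ b + z → x ≡ a + b + z
+-trans {z = z} a b x≡a+y y≡b+z = trans x≡a+y (trans (cong (a +_) y≡b+z) (sym (+-assoc a b z)))

forestWord : List PlaneTree → List Step → List Step
forestWord []             r = r
forestWord (node cs ∷ ts) r = U ∷ forestWord cs (D ∷ forestWord ts r)

treeWord : PlaneTree → List Step
treeWord (node cs) = forestWord cs []

countU-forestWord : ∀ f r → countU (forestWord f r) ≡ verticesF f + countU r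
countU-forestWord []             r = refl
countU-forestWord (node cs ∷ ts) r =
  cong suc (+-trans (verticesF cs) (verticesF ts) (countU-forestWord cs _) (countU-forestWord ts r))

countD-forestWord : ∀ f r → countD (forestWord f r) ≡ verticesF f + countD r
countD-forestWord []             r = refl
countD-forestWord (node cs ∷ ts) r = begin
  countD (forestWord cs (D ∷ forestWord ts r))   ≡⟨ countD-forestWord cs _ ⟩
  verticesF cs + suc (countD (forestWord ts r))  ≡⟨ +-suc (verticesF cs) _ ⟩
  suc (verticesF cs + countD (forestWord ts r))
    ≡⟨ cong suc (+-trans (verticesF cs) (verticesF ts) refl (countD-forestWord ts r)) ⟩
  suc (verticesF cs + verticesF ts + countD r)   ∎
  where open ≡-Reasoning

UD-factors-forestWord : ∀ f r → UD-factors (forestWord f r) ≡ leavesF f + UD-factors r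
UD-factors-forestWord []                          r = refl
UD-factors-forestWord (node [] ∷ ts)              r = cong suc (UD-factors-forestWord ts r)
UD-factors-forestWord (node (node ds ∷ cs) ∷ ts) r =
  +-trans (leavesF (node ds ∷ cs)) (leavesF ts)
    (UD-factors-forestWord (node ds ∷ cs) _) (UD-factors-forestWord ts r)

UUD-factors-forestWord : ∀ f r → UUD-factors (forestWord f r) ≡ goodLeavesF f + UUD-factors r
UUD-factors-forestWord []                                    r = refl
UUD-factors-forestWord (node [] ∷ ts)                        r = UUD-factors-forestWord ts r
UUD-factors-forestWord (node (node [] ∷ cs) ∷ ts)            r =
  cong suc (+-trans (goodLeavesF cs) (goodLeavesF ts)
    (UUD-factors-forestWord cs _) (UUD-factors-forestWord ts r))
UUD-factors-forestWord (node (node (node es ∷ ds) ∷ cs) ∷ ts) r =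
  +-trans (goodLeavesF (node (node es ∷ ds) ∷ cs)) (goodLeavesF ts)
    (UUD-factors-forestWord (node (node es ∷ ds) ∷ cs) _) (UUD-factors-forestWord ts r)

treeWord-countU : ∀ t → countU (treeWord t) ≡ nonRootVertices t
treeWord-countU (node cs) = trans (countU-forestWord cs []) (+-identityʳ _)

treeWord-countD : ∀ t → countD (treeWord t) ≡ nonRootVertices t
treeWord-countD (node cs) = trans (countD-forestWord cs []) (+-identityʳ _)

treeWord-UD-factors : ∀ t → UD-factors (treeWord t) ≡ leaves t
treeWord-UD-factors (node cs) = trans (UD-factors-forestWord cs []) (+-identityʳ _)

treeWord-UUD-factors : ∀ t → UUD-factors (treeWord t) ≡ goodLeaves t
treeWord-UUD-factors (node cs) = trans (UUD-factors-forestWord cs []) (+-identityʳ _)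

staysNonnegFrom : ℕ → List Step → Bool
staysNonnegFrom h       []      = true
staysNonnegFrom h       (U ∷ w) = staysNonnegFrom (suc h) w
staysNonnegFrom zero    (D ∷ w) = false
staysNonnegFrom (suc h) (D ∷ w) = staysNonnegFrom h w

dropsAtMost : ℕ → List Step → Bool
dropsAtMost h p = countD p ≤ᵇ h + countU p

allB-inits-staysNonnegFrom : ∀ h w → allB (dropsAtMost h) (inits w) ≡ staysNonnegFrom h w
allB-inits-staysNonnegFrom h [] = refl
allB-inits-staysNonnegFrom h (U ∷ w) =
  trans (allB-map (dropsAtMost h) (U ∷_) up (inits w)) (allB-inits-staysNonnegFrom (suc h) w)
  where
  up : ∀ p → dropsAtMost h (U ∷ p) ≡ dropsAtMost (suc h) p
  up p = cong (countD p ≤ᵇ_) (+-suc h (countU p))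
allB-inits-staysNonnegFrom zero (D ∷ w) = refl
allB-inits-staysNonnegFrom (suc h) (D ∷ w) =
  trans (allB-map (dropsAtMost (suc h)) (D ∷_) down (inits w)) (allB-inits-staysNonnegFrom h w)
  where
  down : ∀ p → dropsAtMost (suc h) (D ∷ p) ≡ dropsAtMost h p
  down p = suc-≤ᵇ-suc (countD p) (h + countU p)

prefixesOK≡staysNonnegFrom0 : ∀ w → prefixesOK w ≡ staysNonnegFrom 0 w
prefixesOK≡staysNonnegFrom0 = allB-inits-staysNonnegFrom 0

staysNonnegFrom-forestWord : ∀ h f r → staysNonnegFrom h (forestWord f r) ≡ staysNonnegFrom h r
staysNonnegFrom-forestWord h []             r = refl
staysNonnegFrom-forestWord h (node cs ∷ ts) r =
  trans (staysNonnegFrom-forestWord (suc h) cs _) (staysNonnegFrom-forestWord h ts r)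

treeWord-isDyckPath : ∀ t → IsDyckPath (nonRootVertices t) (treeWord t)
treeWord-isDyckPath t@(node cs) = prefixes , treeWord-countU t , treeWord-countD t
  where
  prefixes : T (prefixesOK (treeWord t))
  prefixes = subst T (sym (trans (prefixesOK≡staysNonnegFrom0 (treeWord t))
                                 (staysNonnegFrom-forestWord 0 cs []))) tt

-- closers (g₁ ∷ ⋯ ∷ g_h ∷ []) is D g₁ D g₂ ⋯ D g_h, a walk from height h down to 0.
closers : List (List PlaneTree) → List Step
closers []       = []
closers (g ∷ gs) = D ∷ forestWord g (closers gs)

nonneg-walk-decomposition : ∀ h w → T (staysNonnegFrom h w) → countD w ≡ h + countU w →
  ∃₂ λ f gs → length gs ≡ h × forestWord f (closers gs) ≡ w
nonneg-walk-decomposition zero    []      _   _  = [] , [] , refl , refl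
nonneg-walk-decomposition (suc h) []      _   ()
nonneg-walk-decomposition (suc h) (D ∷ w) ok  eq
  with nonneg-walk-decomposition h w ok (suc-injective eq)
... | f , gs , len , w≡ = [] , f ∷ gs , cong suc len , cong (D ∷_) w≡
nonneg-walk-decomposition h       (U ∷ w) ok  eq
  with nonneg-walk-decomposition (suc h) w ok (trans eq (+-suc h (countU w)))
... | f , g ∷ gs , len , w≡ = node f ∷ g , gs , suc-injective len , cong (U ∷_) w≡

dyckPath-forestWord : ∀ {n} w → IsDyckPath n w → ∃ λ f → forestWord f [] ≡ w
dyckPath-forestWord w (ok , #U≡n , #D≡n)
  with nonneg-walk-decomposition 0 w (subst T (prefixesOK≡staysNonnegFrom0 w) ok)
                                     (trans #D≡n (sym #U≡n))
... | f , [] , _ , w≡ = f , w≡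

-- acc holds, reversed, the trees completed at the current level; st the unfinished levels above.
decodeWith : List Step → List PlaneTree → List (List PlaneTree) → List PlaneTree
decodeWith []      acc st       = reverse acc
decodeWith (U ∷ w) acc st       = decodeWith w [] (acc ∷ st)
decodeWith (D ∷ w) acc []       = reverse acc
decodeWith (D ∷ w) acc (p ∷ st) = decodeWith w (node (reverse acc) ∷ p) st

decodeTree : List Step → PlaneTree
decodeTree w = node (decodeWith w [] [])

decodeWith-forestWord : ∀ f r acc st →
  decodeWith (forestWord f r) acc st ≡ decodeWith r (f ʳ++ acc) st
decodeWith-forestWord []             r acc st = refl
decodeWith-forestWord (node cs ∷ ts) r acc st = begin
  decodeWith (forestWord cs (D ∷ forestWord ts r)) [] (acc ∷ st)
    ≡⟨ decodeWith-forestWord cs _ [] _ ⟩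
  decodeWith (forestWord ts r) (node (reverse (reverse cs)) ∷ acc) st
    ≡⟨ cong (λ cs′ → decodeWith (forestWord ts r) (node cs′ ∷ acc) st) (reverse-involutive cs) ⟩
  decodeWith (forestWord ts r) (node cs ∷ acc) st
    ≡⟨ decodeWith-forestWord ts r _ st ⟩
  decodeWith r (ts ʳ++ node cs ∷ acc) st
    ∎
  where open ≡-Reasoning

decodeTree-treeWord : ∀ t → decodeTree (treeWord t) ≡ t
decodeTree-treeWord (node cs) =
  cong node (trans (decodeWith-forestWord cs [] [] []) (reverse-involutive cs))

treeWord-decodeTree : ∀ {n} w → IsDyckPath n w → treeWord (decodeTree w) ≡ w
treeWord-decodeTree w dyck with dyckPath-forestWord w dyck
... | f , refl = cong treeWord (decodeTree-treeWord (node f))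

DyckPathWith : ℕ → ℕ → ℕ → List Step → Set
DyckPathWith n k m w = IsDyckPath n w × UD-factors w ≡ k × UUD-factors w ≡ m

PlaneTreeWith : ℕ → ℕ → ℕ → PlaneTree → Set
PlaneTreeWith n k m t = nonRootVertices t ≡ n × leaves t ≡ k × goodLeaves t ≡ m

DyckPathWith-irrelevant : ∀ n k m w → Irrelevant (DyckPathWith n k m w)
DyckPathWith-irrelevant n k m w =
  ×-irrelevant (×-irrelevant T-irrelevant (×-irrelevant ≡-irrelevant ≡-irrelevant))
               (×-irrelevant ≡-irrelevant ≡-irrelevant)

PlaneTreeWith-irrelevant : ∀ n k m t → Irrelevant (PlaneTreeWith n k m t)
PlaneTreeWith-irrelevant n k m t =
  ×-irrelevant ≡-irrelevant (×-irrelevant ≡-irrelevant ≡-irrelevant)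

treeWord-with : ∀ {n k m} t → PlaneTreeWith n k m t → DyckPathWith n k m (treeWord t)
treeWord-with t (refl , refl , refl) =
  treeWord-isDyckPath t , treeWord-UD-factors t , treeWord-UUD-factors t

with-treeWord : ∀ {n k m} t → DyckPathWith n k m (treeWord t) → PlaneTreeWith n k m t
with-treeWord t ((_ , #U≡n , _) , #UD≡k , #UUD≡m) =
  trans (sym (treeWord-countU t)) #U≡n ,
  trans (sym (treeWord-UD-factors t)) #UD≡k ,
  trans (sym (treeWord-UUD-factors t)) #UUD≡m

decodeTree-with : ∀ {n k m} w → DyckPathWith n k m w → PlaneTreeWith n k m (decodeTree w)
decodeTree-with {n} {k} {m} w d =
  with-treeWord (decodeTree w) (subst (DyckPathWith n k m) (sym (treeWord-decodeTree w (proj₁ d))) d)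

proposition3p1 : (n k m : ℕ) →
    Σ (List Step) (λ w → IsDyckPath n w × UD-factors w ≡ k × UUD-factors w ≡ m)
      ↔ Σ PlaneTree (λ t → nonRootVertices t ≡ n × leaves t ≡ k × goodLeaves t ≡ m)
proposition3p1 n k m =
  Σ-irrelevant-↔ (DyckPathWith-irrelevant n k m) (PlaneTreeWith-irrelevant n k m)
    decodeTree treeWord decodeTree-with treeWord-with
    (λ w d → treeWord-decodeTree w (proj₁ d)) decodeTree-treeWord
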